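{- Let constants satisfy $\beta\gg\varepsilon\gg m/n\gg\alpha\gg1/n$. Let $G$ be a graph whose vertex set is partitioned as $V(G)=P\cup Q\cup S$ with $n\ge|P|,|Q|,|S|\ge\sqrt{\varepsilon}\,m$ and $\alpha(G)<\alpha n$. Suppose that each of the pairs $(P,Q)$, $(Q,S)$, $(S,P)$ is $\sqrt{\varepsilon}$-regular with density at least $\beta-\varepsilon$. Then for every $2$-edge-colouring $\varphi$ of $G$, there is a monochromatic triangle $K$ in $G$ with \[ |V(K)\cap S|\le1,\qquad |V(K)\cap P|\le2,\qquad |V(K)\cap Q|\le 2. \]
   Context: The hierarchy $\beta\gg\varepsilon\gg m/n\gg\alpha\gg1/n$ means: $\varepsilon$ is sufficiently small in terms of $\beta$, $m/n$ sufficiently small in terms of $\varepsilon$, $\alpha$ sufficiently small in terms of $m/n$, and $n$ sufficiently large in terms of $\alpha$. For disjoint vertex sets $X,Y$, $d(X,Y)=e(X,Y)/(|X||Y|)$ with $e(X,Y)$ the number of edges between $X$ and $Y$. A pair $(A,B)$ is $\eta$-regular if for all $X\subseteq A$, $Y\subseteq B$ with $|X|\ge\eta|A|$, $|Y|\ge\eta|B|$, $|d(X,Y)-d(A,B)|\le\eta$. A monochromatic triangle is a triangle all of whose edges receive the same colour. $\alpha(G)$ is the independence number. -}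

module Defs where

open import Data.Nat as ℕ using (ℕ; zero; suc)
open import Data.Fin as Fin using (Fin)
open import Data.Bool using (Bool; true; false; T; if_then_else_; _∧_)
open import Data.List using (List; allFin; map)
open import Data.Nat.ListAction using (sum)
open import Data.Integer using (+_)
open import Data.Rational as ℚ using (ℚ; 0ℚ; _≤_; _*_; _-_)
open import Data.Product using (Σ; _×_)
open import Relation.Binary.PropositionalEquality using (_≡_)

record Graph : Set where
  field
    size : ℕ
    adj  : Fin size → Fin size → Bool
    adj-sym   : ∀ u v → adj u v ≡ adj v u
    adj-irrefl : ∀ v → adj v v ≡ false

VSet : ℕ → Set
VSet k = Fin k → Bool

_⊆_ : ∀ {k} → VSet k → VSet k → Set
X ⊆ Y = ∀ v → T (X v) → T (Y v)

ind : Bool → ℕ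
ind b = if b then 1 else 0

card : ∀ {k} → VSet k → ℕ
card {k} X = sum (map (λ v → ind (X v)) (allFin k))

-- e(X,Y): number of pairs (x,y) with x ∈ X, y ∈ Y, xy ∈ E(G)
-- (for disjoint X, Y this is the number of X–Y edges).
eCount : (G : Graph) → VSet (Graph.size G) → VSet (Graph.size G) → ℕ
eCount G X Y =
  sum (map (λ u → sum (map (λ v → ind (X u ∧ Y v ∧ Graph.adj G u v))
                           (allFin (Graph.size G))))
           (allFin (Graph.size G)))

-- a / b as a rational, with the (irrelevant) convention a / 0 = 0
divℕ : ℕ → ℕ → ℚ
divℕ a zero = 0ℚ
divℕ a (suc b) = (+ a) ℚ./ suc b

density : (G : Graph) → VSet (Graph.size G) → VSet (Graph.size G) → ℚ
density G X Y = divℕ (eCount G X Y) (card X ℕ.* card Y)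

ℕtoℚ : ℕ → ℚ
ℕtoℚ n = (+ n) ℚ./ 1

-- (A,B) is √e-regular (e ≥ 0), with the square roots eliminated:
-- |X| ≥ √e |A|  ⇔  |X|² ≥ e |A|²  and  |d(X,Y) - d(A,B)| ≤ √e  ⇔  (d(X,Y) - d(A,B))² ≤ e.
SqrtRegular : (G : Graph) → ℚ → VSet (Graph.size G) → VSet (Graph.size G) → Set
SqrtRegular G e A B =
  ∀ (X Y : VSet (Graph.size G)) → X ⊆ A → Y ⊆ B →
    e * (ℕtoℚ (card A) * ℕtoℚ (card A)) ≤ ℕtoℚ (card X) * ℕtoℚ (card X) →
    e * (ℕtoℚ (card B) * ℕtoℚ (card B)) ≤ ℕtoℚ (card Y) * ℕtoℚ (card Y) →
    (density G X Y - density G A B) * (density G X Y - density G A B) ≤ e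

Independent : (G : Graph) → VSet (Graph.size G) → Set
Independent G I = ∀ u v → T (I u) → T (I v) → Graph.adj G u v ≡ false

{-# OPTIONS --safe #-}
-- Regularity of (S,P) and (S,Q) leaves few vertices of S with low degree into P or into Q,
-- so some x ∈ S has many neighbours in both; let A ⊆ P and B ⊆ Q be its neighbourhoods in
-- the majority colours c₁ and c₂. Both are large, so regularity of (P,Q) gives
-- e(A,B) ≥ |A||B|/c. Suppose no admissible monochromatic triangle exists. For v ∈ B, the
-- neighbours of v in A joined to v in colour ¬c₁ form an independent set: an edge among them
-- is monochromatic with x (colour c₁) or with v (colour ¬c₁). Symmetrically for u ∈ A. An
-- A–B edge uv lying in neither kind of set has colour c₁ = c₂ and closes a monochromatic
-- triangle xuv. Hence e(A,B) ≤ (|A| + |B|)·α(G), which the smallness of α(G) makes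
-- incompatible with the lower bound. The triangles involved have classes SPP, QPP, SQQ, PQQ
-- and SPQ, all of the required form.
module Submission where

open import Defs
open import Data.Nat as ℕ using (ℕ; zero; suc)
import Data.Nat.Properties as ℕP
open import Data.Fin as Fin using (Fin)
open import Data.Bool using (Bool; true; false; T; _∧_; not)
import Data.Bool.Properties as BoolP
open import Data.Product using (Σ; ∃; _×_; _,_; proj₁; proj₂)
open import Data.Sum using (_⊎_; inj₁; inj₂)
open import Data.Empty using (⊥; ⊥-elim)
open import Function using (id; _∘_)
open import Relation.Binary.PropositionalEquality
open import Relation.Nullary using (Dec; yes; no; ¬_; ¬?)
open import Relation.Nullary.Decidable using (isYes; True; toWitness; fromWitness; _×-dec_; decidable-stable; T?)
open import Data.Nat.Tactic.RingSolver using (solve-∀)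

module Arithmetic where

  open import Data.Nat using (_+_; _*_; _≤_; _<_; z≤n; s≤s)

  m*n>0⇒n>0 : ∀ m {n} → 0 < m * n → 0 < n
  m*n>0⇒n>0 m {zero} m*0>0 = ⊥-elim (ℕP.<-irrefl (sym (ℕP.*-zeroʳ m)) m*0>0)
  m*n>0⇒n>0 m {suc n} _ = s≤s z≤n

  n+n≡2*n : ∀ n → n + n ≡ 2 * n
  n+n≡2*n = solve-∀

  m≤a+b⇒m≤2a⊎m≤2b : ∀ {m a b} → m ≤ a + b → m ≤ 2 * a ⊎ m ≤ 2 * b
  m≤a+b⇒m≤2a⊎m≤2b {m} {a} {b} m≤a+b with ℕP.≤-total a b
  ... | inj₁ a≤b = inj₂ (ℕP.≤-trans m≤a+b (subst (a + b ≤_) (n+n≡2*n b) (ℕP.+-monoˡ-≤ b a≤b)))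
  ... | inj₂ b≤a = inj₁ (ℕP.≤-trans m≤a+b (subst (a + b ≤_) (n+n≡2*n a) (ℕP.+-monoʳ-≤ a b≤a)))

  2a<s⇒2b<s⇒a+b<s : ∀ {a b s} → 2 * a < s → 2 * b < s → a + b < s
  2a<s⇒2b<s⇒a+b<s {a} {b} 2a<s 2b<s with m≤a+b⇒m≤2a⊎m≤2b {a + b} {a} {b} ℕP.≤-refl
  ... | inj₁ ≤2a = ℕP.≤-<-trans ≤2a 2a<s
  ... | inj₂ ≤2b = ℕP.≤-<-trans ≤2b 2b<s

  m*m≤e*[n*n]⇒m≤e*n : ∀ {m e n} .{{_ : ℕ.NonZero e}} → m * m ≤ e * (n * n) → m ≤ e * n
  m*m≤e*[n*n]⇒m≤e*n {m} {e} {n} mm≤enn with m ℕ.≤? e * n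
  ... | yes m≤en = m≤en
  ... | no m≰en = ⊥-elim (ℕP.<-irrefl refl (begin-strict
    e * (n * n)      ≤⟨ ℕP.*-monoˡ-≤ (n * n) (ℕP.m≤m*n e e) ⟩
    e * e * (n * n)  ≡⟨ regroup e n ⟩
    e * n * (e * n)  <⟨ ℕP.*-mono-< en<m en<m ⟩
    m * m            ≤⟨ mm≤enn ⟩
    e * (n * n)      ∎))
    where
    open ℕP.≤-Reasoning
    en<m = ℕP.≰⇒> m≰en
    regroup : ∀ e n → e * e * (n * n) ≡ e * n * (e * n)
    regroup = solve-∀

  dense∧sparse⇒a*b≡0 : ∀ {a b c e n R} → a * b ≤ c * e → suc (2 * c * R) * e ≤ (b + a) * n →
                       n ≤ R * a → n ≤ R * b → a * b ≡ 0
  dense∧sparse⇒a*b≡0 {a} {b} {c} {e} {n} {R} ab≤ce sparse n≤Ra n≤Rb =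
    ℕP.n≤0⇒n≡0 (ℕP.+-cancelʳ-≤ (2 * c * R * (a * b)) (a * b) 0 (begin
      suc (2 * c * R) * (a * b)          ≤⟨ ℕP.*-monoʳ-≤ (suc (2 * c * R)) ab≤ce ⟩
      suc (2 * c * R) * (c * e)          ≡⟨ regroup₁ c R e ⟩
      c * (suc (2 * c * R) * e)          ≤⟨ ℕP.*-monoʳ-≤ c sparse ⟩
      c * ((b + a) * n)                  ≡⟨ regroup₂ a b c n ⟩
      c * b * n + c * a * n              ≤⟨ ℕP.+-mono-≤ (ℕP.*-monoʳ-≤ (c * b) n≤Ra) (ℕP.*-monoʳ-≤ (c * a) n≤Rb) ⟩
      c * b * (R * a) + c * a * (R * b)  ≡⟨ regroup₃ a b c R ⟩
      2 * c * R * (a * b)                ∎))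
    where
    open ℕP.≤-Reasoning
    regroup₁ : ∀ c R e → suc (2 * c * R) * (c * e) ≡ c * (suc (2 * c * R) * e)
    regroup₁ = solve-∀
    regroup₂ : ∀ a b c n → c * ((b + a) * n) ≡ c * b * n + c * a * n
    regroup₂ = solve-∀
    regroup₃ : ∀ a b c R → c * b * (R * a) + c * a * (R * b) ≡ 2 * c * R * (a * b)
    regroup₃ = solve-∀

module Counting where

  open import Data.Nat using (_+_; _*_; _≤_; _<_; z≤n; s≤s)
  open import Data.Nat.ListAction using (sum)
  open import Data.List using (allFin; map; tabulate)
  import Data.List.Properties as ListP
  open import Function.Bundles using (Equivalence)
  open import Algebra.Properties.CommutativeMonoid.Sum ℕP.+-0-commutativeMonoid
    using (sum-syntax; ∑-distrib-+; ∑-comm; sum-cong-≗; sum-replicate-zero)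
  open import Algebra.Properties.Semiring.Sum ℕP.+-*-semiring using (*-distribˡ-sum; *-distribʳ-sum)
  open Arithmetic

  ∑-mono-≤ : ∀ {n} {f g : Fin n → ℕ} → (∀ i → f i ≤ g i) → ∑[ i < n ] f i ≤ ∑[ i < n ] g i
  ∑-mono-≤ {zero} f≤g = z≤n
  ∑-mono-≤ {suc n} f≤g = ℕP.+-mono-≤ (f≤g Fin.zero) (∑-mono-≤ (f≤g ∘ Fin.suc))

  ∑∑-distrib-+ : ∀ {m n} (f : Fin n → Fin m → ℕ) (g : Fin m → Fin n → ℕ) →
                 ∑[ u < m ] ∑[ v < n ] (f v u + g u v) ≡ ∑[ v < n ] ∑[ u < m ] f v u + ∑[ u < m ] ∑[ v < n ] g u v
  ∑∑-distrib-+ {m} {n} f g = begin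
    ∑[ u < m ] ∑[ v < n ] (f v u + g u v)                      ≡⟨ sum-cong-≗ (λ u → ∑-distrib-+ (λ v → f v u) (g u)) ⟩
    ∑[ u < m ] (∑[ v < n ] f v u + ∑[ v < n ] g u v)           ≡⟨ ∑-distrib-+ (λ u → ∑[ v < n ] f v u) (λ u → ∑[ v < n ] g u v) ⟩
    ∑[ u < m ] ∑[ v < n ] f v u + ∑[ u < m ] ∑[ v < n ] g u v  ≡⟨ cong (_+ ∑[ u < m ] ∑[ v < n ] g u v) (∑-comm (λ u v → f v u)) ⟩
    ∑[ v < n ] ∑[ u < m ] f v u + ∑[ u < m ] ∑[ v < n ] g u v  ∎
    where open ≡-Reasoning

  sum-map-allFin : ∀ {n} (f : Fin n → ℕ) → sum (map f (allFin n)) ≡ ∑[ i < n ] f i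
  sum-map-allFin {n} f = trans (cong sum (ListP.map-tabulate id f)) (sum-tabulate f)
    where
    sum-tabulate : ∀ {m} (g : Fin m → ℕ) → sum (tabulate g) ≡ ∑[ i < m ] g i
    sum-tabulate {zero} g = refl
    sum-tabulate {suc m} g = cong (g Fin.zero +_) (sum-tabulate (g ∘ Fin.suc))

  ind-≤-+ : ∀ {a b c} → (T a → T b ⊎ T c) → ind a ≤ ind b + ind c
  ind-≤-+ {false} _ = z≤n
  ind-≤-+ {true} {true} _ = s≤s z≤n
  ind-≤-+ {true} {false} {true} _ = s≤s z≤n
  ind-≤-+ {true} {false} {false} cover with cover _
  ... | inj₁ ()
  ... | inj₂ ()

  T-∧-intro : ∀ {a b} → T a → T b → T (a ∧ b)
  T-∧-intro ta tb = Equivalence.from BoolP.T-∧ (ta , tb)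

  T-∧-elim : ∀ {a b} → T (a ∧ b) → T a × T b
  T-∧-elim = Equivalence.to BoolP.T-∧

  module _ {k : ℕ} where

    infixr 6 _∩_
    _∩_ : VSet k → VSet k → VSet k
    (X ∩ Y) v = X v ∧ Y v

    card-∑ : (X : VSet k) → card X ≡ ∑[ v < k ] ind (X v)
    card-∑ X = sum-map-allFin (λ v → ind (X v))

    card-∅ : card {k} (λ _ → false) ≡ 0
    card-∅ = trans (card-∑ _) (sum-replicate-zero k)

    card-∧ˡ : ∀ b (X : VSet k) → card (λ v → b ∧ X v) ≡ ind b * card X
    card-∧ˡ true X = sym (ℕP.*-identityˡ (card X))
    card-∧ˡ false X = card-∅

    card-≤-+ : (X Y Z : VSet k) → (∀ v → T (X v) → T (Y v) ⊎ T (Z v)) → card X ≤ card Y + card Z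
    card-≤-+ X Y Z cover = begin
      card X                                       ≡⟨ card-∑ X ⟩
      ∑[ v < k ] ind (X v)                         ≤⟨ ∑-mono-≤ (λ v → ind-≤-+ (cover v)) ⟩
      ∑[ v < k ] (ind (Y v) + ind (Z v))           ≡⟨ ∑-distrib-+ (ind ∘ Y) (ind ∘ Z) ⟩
      ∑[ v < k ] ind (Y v) + ∑[ v < k ] ind (Z v)  ≡⟨ cong₂ _+_ (card-∑ Y) (card-∑ Z) ⟨
      card Y + card Z                              ∎
      where open ℕP.≤-Reasoning

    *-∑-≤ : ∀ {c r} (X : VSet k) (f : Fin k → ℕ) → (∀ u → T (X u) → c * f u ≤ r) →
            c * ∑[ u < k ] (ind (X u) * f u) ≤ card X * r
    *-∑-≤ {c} {r} X f bound = begin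
      c * ∑[ u < k ] (ind (X u) * f u)    ≡⟨ *-distribˡ-sum c (λ u → ind (X u) * f u) ⟩
      ∑[ u < k ] (c * (ind (X u) * f u))  ≤⟨ ∑-mono-≤ term ⟩
      ∑[ u < k ] (ind (X u) * r)          ≡⟨ *-distribʳ-sum r (ind ∘ X) ⟨
      (∑[ u < k ] ind (X u)) * r          ≡⟨ cong (_* r) (card-∑ X) ⟨
      card X * r                          ∎
      where
      open ℕP.≤-Reasoning
      term : ∀ u → c * (ind (X u) * f u) ≤ ind (X u) * r
      term u with X u | bound u
      ... | false | _ = ℕP.≤-reflexive (ℕP.*-zeroʳ c)
      ... | true  | b = subst₂ _≤_ (cong (c *_) (sym (ℕP.*-identityˡ _))) (sym (ℕP.*-identityˡ r)) (b _)

  module _ (G : Graph) where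

    open Graph G

    deg : VSet size → Fin size → ℕ
    deg Y u = card (Y ∩ adj u)

    eCount-∑ : ∀ X Y → eCount G X Y ≡ ∑[ u < size ] ∑[ v < size ] ind (X u ∧ Y v ∧ adj u v)
    eCount-∑ X Y = trans (sum-map-allFin (λ u → card (λ v → X u ∧ (Y ∩ adj u) v)))
                         (sum-cong-≗ (λ u → sum-map-allFin (λ v → ind (X u ∧ Y v ∧ adj u v))))

    eCount-deg : ∀ X Y → eCount G X Y ≡ ∑[ u < size ] (ind (X u) * deg Y u)
    eCount-deg X Y = trans (sum-map-allFin (λ u → card (λ v → X u ∧ (Y ∩ adj u) v)))
                           (sum-cong-≗ (λ u → card-∧ˡ (X u) (Y ∩ adj u)))

    eCount-comm : ∀ X Y → eCount G X Y ≡ eCount G Y X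
    eCount-comm X Y = begin
      eCount G X Y                                           ≡⟨ eCount-∑ X Y ⟩
      ∑[ u < size ] ∑[ v < size ] ind (X u ∧ Y v ∧ adj u v)  ≡⟨ ∑-comm (λ u v → ind (X u ∧ Y v ∧ adj u v)) ⟩
      ∑[ v < size ] ∑[ u < size ] ind (X u ∧ Y v ∧ adj u v)  ≡⟨ sum-cong-≗ (λ v → sum-cong-≗ (λ u → cong ind (swap u v))) ⟩
      ∑[ v < size ] ∑[ u < size ] ind (Y v ∧ X u ∧ adj v u)  ≡⟨ eCount-∑ Y X ⟨
      eCount G Y X                                           ∎
      where
      open ≡-Reasoning
      swap : ∀ u v → X u ∧ Y v ∧ adj u v ≡ Y v ∧ X u ∧ adj v u
      swap u v rewrite adj-sym u v = begin
        X u ∧ (Y v ∧ adj v u)  ≡⟨ BoolP.∧-assoc (X u) (Y v) (adj v u) ⟨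
        (X u ∧ Y v) ∧ adj v u  ≡⟨ cong (_∧ adj v u) (BoolP.∧-comm (X u) (Y v)) ⟩
        (Y v ∧ X u) ∧ adj v u  ≡⟨ BoolP.∧-assoc (Y v) (X u) (adj v u) ⟩
        Y v ∧ (X u ∧ adj v u)  ∎

    *-eCount-≤ : ∀ c {r} X Y → (∀ u → T (X u) → c * deg Y u ≤ r) → c * eCount G X Y ≤ card X * r
    *-eCount-≤ c {r} X Y bound =
      subst (λ e → c * e ≤ card X * r) (sym (eCount-deg X Y)) (*-∑-≤ {c = c} X (deg Y) bound)

  SubpairDense : (G : Graph) (L c : ℕ) (A B : VSet (Graph.size G)) → Set
  SubpairDense G L c A B =
    ∀ X Y → X ⊆ A → Y ⊆ B → card A ≤ L * card X → card B ≤ L * card Y →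
      card X * card Y ≤ c * eCount G X Y

  subpairDense-sym : ∀ {G L c A B} → SubpairDense G L c A B → SubpairDense G L c B A
  subpairDense-sym {G} {c = c} dense X Y X⊆B Y⊆A B≤LX A≤LY =
    subst₂ _≤_ (ℕP.*-comm (card Y) (card X)) (cong (c *_) (eCount-comm G Y X)) (dense Y X Y⊆A X⊆B A≤LY B≤LX)

  -- The vertices of A of low degree into B span too few edges to B to form a dense subpair.
  lowDegree-small : ∀ {G L c A B} .{{_ : ℕ.NonZero L}} → SubpairDense G L c A B → 0 < card A → 0 < card B →
                    (X : VSet (Graph.size G)) → X ⊆ A → (∀ x → T (X x) → 2 * c * deg G B x < card B) →
                    L * card X < card A
  lowDegree-small {G} {L} {c} {A} {B} dense A>0 B>0 X X⊆A low with card A ℕ.≤? L * card X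
  ... | no A≰LX = ℕP.≰⇒> A≰LX
  ... | yes A≤LX = ⊥-elim (ℕP.<-irrefl refl (begin-strict
    c * e            <⟨ ℕP.m<m+n (c * e) ce>0 ⟩
    c * e + c * e    ≡⟨ n+n≡2*n (c * e) ⟩
    2 * (c * e)      ≡⟨ ℕP.*-assoc 2 c e ⟨
    2 * c * e        ≤⟨ *-eCount-≤ G (2 * c) X B (λ x x∈X → ℕP.<⇒≤ (low x x∈X)) ⟩
    card X * card B  ≤⟨ XB≤ce ⟩
    c * e            ∎))
    where
    open ℕP.≤-Reasoning
    e = eCount G X B
    XB≤ce : card X * card B ≤ c * e
    XB≤ce = dense X B X⊆A (λ _ → id) A≤LX (ℕP.m≤n*m (card B) L)
    ce>0 : 0 < c * e
    ce>0 = ℕP.<-≤-trans (ℕP.*-mono-< (m*n>0⇒n>0 L (ℕP.<-≤-trans A>0 A≤LX)) B>0) XB≤ce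

module Colouring (G : Graph) (φ : Fin (Graph.size G) → Fin (Graph.size G) → Bool)
                 (φ-sym : ∀ u v → φ u v ≡ φ v u) where

  open import Data.Nat using (_+_; _*_; _≤_)
  import Data.Bool as Bool
  open import Function.Bundles using (Equivalence)
  open import Algebra.Properties.CommutativeMonoid.Sum ℕP.+-0-commutativeMonoid using (sum-syntax; sum-cong-≗)
  open Arithmetic
  open Counting
  open Graph G

  Monochromatic : Fin size → Fin size → Fin size → Set
  Monochromatic x y z = adj x y ≡ true × adj y z ≡ true × adj x z ≡ true × φ x y ≡ φ y z × φ y z ≡ φ x z

  nbhd : Fin size → Bool → VSet size → VSet size
  nbhd v c Y = Y ∩ adj v ∩ λ u → isYes (φ v u Bool.≟ c)

  nbhd-intro : ∀ {v c} Y {u} → T (Y u) → adj v u ≡ true → φ v u ≡ c → T (nbhd v c Y u)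
  nbhd-intro Y u∈Y vu vu≡c = T-∧-intro u∈Y (T-∧-intro (Equivalence.from BoolP.T-≡ vu) (fromWitness vu≡c))

  nbhd-elim : ∀ v c Y {u} → T (nbhd v c Y u) → T (Y u) × adj v u ≡ true × φ v u ≡ c
  nbhd-elim v c Y {u} u∈N with T-∧-elim {Y u} u∈N
  ... | u∈Y , u∈N′ with T-∧-elim u∈N′
  ... | vu , vu≡c = u∈Y , Equivalence.to BoolP.T-≡ vu , toWitness vu≡c

  colour-split : ∀ x (Y : VSet size) → deg G Y x ≤ card (nbhd x true Y) + card (nbhd x false Y)
  colour-split x Y = card-≤-+ (Y ∩ adj x) (nbhd x true Y) (nbhd x false Y) by-colour
    where
    by-colour : ∀ u → T ((Y ∩ adj x) u) → T (nbhd x true Y u) ⊎ T (nbhd x false Y u)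
    by-colour u with Y u | adj x u | φ x u
    ... | false | _     | _     = λ ()
    ... | true  | false | _     = λ ()
    ... | true  | true  | true  = λ _ → inj₁ _
    ... | true  | true  | false = λ _ → inj₂ _

  majority-colour : ∀ x (Y : VSet size) → ∃ λ c → deg G Y x ≤ 2 * card (nbhd x c Y)
  majority-colour x Y
    with m≤a+b⇒m≤2a⊎m≤2b {a = card (nbhd x true Y)} {b = card (nbhd x false Y)} (colour-split x Y)
  ... | inj₁ ≤2t = true , ≤2t
  ... | inj₂ ≤2f = false , ≤2f

  large-colour-class : ∀ c x (Y : VSet size) → card Y ≤ 2 * c * deg G Y x →
                       ∃ λ c₁ → card Y ≤ 4 * c * card (nbhd x c₁ Y)
  large-colour-class c x Y Y≤ with majority-colour x Y
  ... | c₁ , deg≤ = c₁ , ℕP.≤-trans Y≤ (ℕP.≤-trans (ℕP.*-monoʳ-≤ (2 * c) deg≤) (ℕP.≤-reflexive (regroup c _)))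
    where
    regroup : ∀ c a → 2 * c * (2 * a) ≡ 4 * c * a
    regroup = solve-∀

  apex-independent : ∀ {y z c} (I : VSet size) →
    (∀ u → T (I u) → adj y u ≡ true × φ y u ≡ c) →
    (∀ u → T (I u) → adj z u ≡ true × φ z u ≡ not c) →
    (∀ u w → T (I u) → T (I w) → ¬ Monochromatic y u w) →
    (∀ u w → T (I u) → T (I w) → ¬ Monochromatic z u w) →
    Independent G I
  apex-independent {c = c} I to-y to-z no-y no-z u w u∈I w∈I
    with to-y u u∈I | to-y w w∈I | to-z u u∈I | to-z w w∈I | adj u w in uw | φ u w Bool.≟ c
  ... | _ | _ | _ | _ | false | _ = refl
  ... | yu , yu≡c | yw , yw≡c | _ | _ | true | yes uw≡c =
    ⊥-elim (no-y u w u∈I w∈I (yu , uw , yw , trans yu≡c (sym uw≡c) , trans uw≡c (sym yw≡c)))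
  ... | _ | _ | zu , zu≡¬c | zw , zw≡¬c | true | no uw≢c =
    ⊥-elim (no-z u w u∈I w∈I (zu , uw , zw , trans zu≡¬c (sym uw≡¬c) , trans uw≡¬c (sym zw≡¬c)))
    where
    uw≡¬c = BoolP.¬-not uw≢c

  -- An A–B edge uv whose colour is neither ¬c₁ nor ¬c₂ closes the monochromatic triangle xuv.
  eCount-≤-crossings : ∀ {x c₁ c₂} (A B : VSet size) →
    (∀ u → T (A u) → adj x u ≡ true × φ x u ≡ c₁) →
    (∀ v → T (B v) → adj x v ≡ true × φ x v ≡ c₂) →
    (∀ u v → T (A u) → T (B v) → ¬ Monochromatic x u v) →
    eCount G A B ≤ ∑[ v < size ] (ind (B v) * card (nbhd v (not c₁) A))
                 + ∑[ u < size ] (ind (A u) * card (nbhd u (not c₂) B))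
  eCount-≤-crossings {x} {c₁} {c₂} A B A-link B-link no-mono = begin
    eCount G A B
      ≡⟨ eCount-∑ G A B ⟩
    ∑[ u < size ] ∑[ v < size ] ind (A u ∧ B v ∧ adj u v)
      ≤⟨ ∑-mono-≤ (λ u → ∑-mono-≤ (λ v → ind-≤-+ (crossing u v))) ⟩
    ∑[ u < size ] ∑[ v < size ] (ind (B v ∧ A′ v u) + ind (A u ∧ B′ u v))
      ≡⟨ ∑∑-distrib-+ (λ v u → ind (B v ∧ A′ v u)) (λ u v → ind (A u ∧ B′ u v)) ⟩
    ∑[ v < size ] ∑[ u < size ] ind (B v ∧ A′ v u) + ∑[ u < size ] ∑[ v < size ] ind (A u ∧ B′ u v)
      ≡⟨ cong₂ _+_ (sum-cong-≗ (λ v → row (B v) (A′ v))) (sum-cong-≗ (λ u → row (A u) (B′ u))) ⟩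
    ∑[ v < size ] (ind (B v) * card (A′ v)) + ∑[ u < size ] (ind (A u) * card (B′ u))
      ∎
    where
    open ℕP.≤-Reasoning
    A′ : Fin size → VSet size
    A′ v = nbhd v (not c₁) A
    B′ : Fin size → VSet size
    B′ u = nbhd u (not c₂) B
    row : ∀ b (X : VSet size) → ∑[ w < size ] ind (b ∧ X w) ≡ ind b * card X
    row b X = trans (sym (card-∑ (λ w → b ∧ X w))) (card-∧ˡ b X)
    crossing : ∀ u v → T (A u ∧ B v ∧ adj u v) → T (B v ∧ A′ v u) ⊎ T (A u ∧ B′ u v)
    crossing u v e with T-∧-elim {A u} e
    ... | u∈A , e′ with T-∧-elim {B v} e′ | φ u v Bool.≟ c₁ | φ u v Bool.≟ c₂
    ... | v∈B , uv | no uv≢c₁ | _ = inj₁ (T-∧-intro v∈B (nbhd-intro A u∈A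
      (trans (adj-sym v u) (Equivalence.to BoolP.T-≡ uv)) (trans (φ-sym v u) (BoolP.¬-not uv≢c₁))))
    ... | v∈B , uv | yes _ | no uv≢c₂ = inj₂ (T-∧-intro u∈A (nbhd-intro B v∈B
      (Equivalence.to BoolP.T-≡ uv) (BoolP.¬-not uv≢c₂)))
    ... | v∈B , uv | yes uv≡c₁ | yes uv≡c₂ = ⊥-elim (no-mono u v u∈A v∈B
      (proj₁ (A-link u u∈A) , Equivalence.to BoolP.T-≡ uv , proj₁ (B-link v v∈B) ,
       trans (proj₂ (A-link u u∈A)) (sym uv≡c₁) , trans uv≡c₂ (sym (proj₂ (B-link v v∈B)))))

module Tripartition (G : Graph) (part : Fin (Graph.size G) → Fin 3)
                    (φ : Fin (Graph.size G) → Fin (Graph.size G) → Bool)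
                    (φ-sym : ∀ u v → φ u v ≡ φ v u) where

  open import Data.Nat using (_+_; _*_; _≤_; _<_; z≤n; s≤s)
  open import Data.Fin.Patterns using (0F; 1F; 2F)
  import Data.Fin.Properties as FinP
  import Data.Bool as Bool
  open import Algebra.Properties.CommutativeMonoid.Sum ℕP.+-0-commutativeMonoid using (sum-syntax)
  open Arithmetic
  open Counting
  open Colouring G φ φ-sym
  open Graph G

  P Q S : VSet size
  P v = isYes (part v Fin.≟ 0F)
  Q v = isYes (part v Fin.≟ 1F)
  S v = isYes (part v Fin.≟ 2F)

  Spread : Fin 3 → Fin 3 → Fin 3 → Set
  Spread i j l = count 2F ≤ 1 × count 0F ≤ 2 × count 1F ≤ 2
    where
    count : Fin 3 → ℕ
    count c = ind (isYes (i Fin.≟ c)) + ind (isYes (j Fin.≟ c)) + ind (isYes (l Fin.≟ c))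

  spread? : ∀ i j l → Dec (Spread i j l)
  spread? i j l = (_ ℕ.≤? 1) ×-dec (_ ℕ.≤? 2) ×-dec (_ ℕ.≤? 2)

  GoodTriangle : Set
  GoodTriangle = Σ (Fin size) λ x → Σ (Fin size) λ y → Σ (Fin size) λ z →
    x ≢ y × y ≢ z × x ≢ z ×
    adj x y ≡ true × adj y z ≡ true × adj x z ≡ true × φ x y ≡ φ y z × φ y z ≡ φ x z ×
    Spread (part x) (part y) (part z)

  good? : Dec GoodTriangle
  good? = FinP.any? λ x → FinP.any? λ y → FinP.any? λ z →
    ¬? (x Fin.≟ y) ×-dec ¬? (y Fin.≟ z) ×-dec ¬? (x Fin.≟ z) ×-dec
    (adj x y Bool.≟ true) ×-dec (adj y z Bool.≟ true) ×-dec (adj x z Bool.≟ true) ×-dec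
    (φ x y Bool.≟ φ y z) ×-dec (φ y z Bool.≟ φ x z) ×-dec spread? (part x) (part y) (part z)

  adj⇒≢ : ∀ {x y} → adj x y ≡ true → x ≢ y
  adj⇒≢ {x} xy refl with trans (sym xy) (adj-irrefl x)
  ... | ()

  -- For concrete classes i j l the implicit proof has type ⊤ and is filled in automatically.
  mono⇒good : ∀ {x y z i j l} → part x ≡ i → part y ≡ j → part z ≡ l → {True (spread? i j l)} →
              Monochromatic x y z → GoodTriangle
  mono⇒good refl refl refl {spread} (xy , yz , xz , mono₁ , mono₂) =
    _ , _ , _ , adj⇒≢ xy , adj⇒≢ yz , adj⇒≢ xz , xy , yz , xz , mono₁ , mono₂ , toWitness spread

  high-degree-vertex : ∀ {c} .{{_ : ℕ.NonZero c}} →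
    SubpairDense G (4 * c) c S P → SubpairDense G (4 * c) c S Q → 0 < card S → 0 < card P → 0 < card Q →
    ∃ λ x → T (S x) × card P ≤ 2 * c * deg G P x × card Q ≤ 2 * c * deg G Q x
  high-degree-vertex {c} dense-SP dense-SQ S>0 P>0 Q>0 = decidable-stable
    (FinP.any? λ x → T? (S x) ×-dec (card P ℕ.≤? 2 * c * deg G P x) ×-dec (card Q ℕ.≤? 2 * c * deg G Q x))
    λ none → ℕP.<-irrefl refl (begin-strict
      card S                       ≤⟨ card-≤-+ S (low P) (low Q) (cover none) ⟩
      card (low P) + card (low Q)  <⟨ 2a<s⇒2b<s⇒a+b<s {card (low P)} {card (low Q)} (small dense-SP P>0) (small dense-SQ Q>0) ⟩
      card S                       ∎)
    where
    open ℕP.≤-Reasoning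
    low : VSet size → VSet size
    low Y = S ∩ λ x → isYes (2 * c * deg G Y x ℕ.<? card Y)
    small : ∀ {Y} → SubpairDense G (4 * c) c S Y → 0 < card Y → 2 * card (low Y) < card S
    small {Y} dense Y>0 = ℕP.≤-<-trans (ℕP.*-monoˡ-≤ (card (low Y)) 2≤4c)
      (lowDegree-small {G} {4 * c} {c} {S} {Y} {{ℕP.m*n≢0 4 c}} dense S>0 Y>0 (low Y)
        (λ x x∈low → proj₁ (T-∧-elim {S x} x∈low)) (λ x x∈low → toWitness (proj₂ (T-∧-elim {S x} x∈low))))
      where
      2≤4c : 2 ≤ 4 * c
      2≤4c = ℕP.≤-trans (s≤s (s≤s z≤n)) (ℕP.m≤m*n 4 c)
    cover : ¬ (∃ λ x → T (S x) × card P ≤ 2 * c * deg G P x × card Q ≤ 2 * c * deg G Q x) →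
            ∀ x → T (S x) → T (low P x) ⊎ T (low Q x)
    cover none x x∈S with 2 * c * deg G P x ℕ.<? card P | 2 * c * deg G Q x ℕ.<? card Q
    ... | yes _ | _ = inj₁ (T-∧-intro x∈S _)
    ... | no _ | yes _ = inj₂ (T-∧-intro x∈S _)
    ... | no highP | no highQ = ⊥-elim (none (x , x∈S , ℕP.≮⇒≥ highP , ℕP.≮⇒≥ highQ))

  module _ (no-good : ¬ GoodTriangle) where

    no-mono : ∀ {x y z i j l} → part x ≡ i → part y ≡ j → part z ≡ l → {True (spread? i j l)} →
              ¬ Monochromatic x y z
    no-mono px py pz {spread} = no-good ∘ mono⇒good px py pz {spread}

    nbhd-independent : ∀ {x v c i j} {Y : VSet size} → part x ≡ 2F → part v ≡ j →
                       (∀ {u} → T (Y u) → part u ≡ i) → {True (spread? 2F i i)} → {True (spread? j i i)} →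
                       Independent G (nbhd v (not c) (nbhd x c Y))
    nbhd-independent {x} {v} {c} {i} {Y = Y} x∈S v∈j Y⊆i {spread₁} {spread₂} =
      apex-independent (nbhd v (not c) (nbhd x c Y))
        (λ u u∈N → proj₂ (nbhd-elim x c Y (proj₁ (nbhd-elim v (not c) (nbhd x c Y) u∈N))))
        (λ u u∈N → proj₂ (nbhd-elim v (not c) (nbhd x c Y) u∈N))
        (λ u w u∈N w∈N → no-mono x∈S (class u∈N) (class w∈N) {spread₁})
        (λ u w u∈N w∈N → no-mono v∈j (class u∈N) (class w∈N) {spread₂})
      where
      class : ∀ {u} → T (nbhd v (not c) (nbhd x c Y) u) → part u ≡ i
      class u∈N = Y⊆i (proj₁ (nbhd-elim x c Y (proj₁ (nbhd-elim v (not c) (nbhd x c Y) u∈N))))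

    edge-bound : ∀ {D n x c₁ c₂} → T (S x) → (∀ I → Independent G I → D * card I ≤ n) →
                 D * eCount G (nbhd x c₁ P) (nbhd x c₂ Q) ≤ (card (nbhd x c₂ Q) + card (nbhd x c₁ P)) * n
    edge-bound {D} {n} {x} {c₁} {c₂} x∈S α-bound = begin
      D * eCount G A B         ≤⟨ ℕP.*-monoʳ-≤ D (eCount-≤-crossings A B A-link B-link no-mono-xAB) ⟩
      D * (∑B + ∑A)            ≡⟨ ℕP.*-distribˡ-+ D ∑B ∑A ⟩
      D * ∑B + D * ∑A          ≤⟨ ℕP.+-mono-≤ (*-∑-≤ {c = D} B (λ v → card (nbhd v (not c₁) A)) B-bound)
                                             (*-∑-≤ {c = D} A (λ u → card (nbhd u (not c₂) B)) A-bound) ⟩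
      card B * n + card A * n  ≡⟨ ℕP.*-distribʳ-+ n (card B) (card A) ⟨
      (card B + card A) * n    ∎
      where
      open ℕP.≤-Reasoning
      A = nbhd x c₁ P
      B = nbhd x c₂ Q
      ∑B = ∑[ v < size ] (ind (B v) * card (nbhd v (not c₁) A))
      ∑A = ∑[ u < size ] (ind (A u) * card (nbhd u (not c₂) B))
      A-link : ∀ u → T (A u) → adj x u ≡ true × φ x u ≡ c₁
      A-link u = proj₂ ∘ nbhd-elim x c₁ P
      B-link : ∀ v → T (B v) → adj x v ≡ true × φ x v ≡ c₂
      B-link v = proj₂ ∘ nbhd-elim x c₂ Q
      no-mono-xAB : ∀ u v → T (A u) → T (B v) → ¬ Monochromatic x u v
      no-mono-xAB u v u∈A v∈B = no-mono (toWitness x∈S) (toWitness (proj₁ (nbhd-elim x c₁ P u∈A)))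
                                         (toWitness (proj₁ (nbhd-elim x c₂ Q v∈B)))
      B-bound : ∀ v → T (B v) → D * card (nbhd v (not c₁) A) ≤ n
      B-bound v v∈B = α-bound (nbhd v (not c₁) A)
        (nbhd-independent {x} {v} {c₁} {Y = P} (toWitness x∈S) (toWitness (proj₁ (nbhd-elim x c₂ Q v∈B))) toWitness)
      A-bound : ∀ u → T (A u) → D * card (nbhd u (not c₂) B) ≤ n
      A-bound u u∈A = α-bound (nbhd u (not c₂) B)
        (nbhd-independent {x} {u} {c₂} {Y = Q} (toWitness x∈S) (toWitness (proj₁ (nbhd-elim x c₁ P u∈A))) toWitness)

  good-triangle : ∀ {c W n} .{{_ : ℕ.NonZero c}} →
    SubpairDense G (4 * c) c P Q → SubpairDense G (4 * c) c S P → SubpairDense G (4 * c) c S Q →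
    (∀ I → Independent G I → suc (2 * c * (W * (4 * c))) * card I < n) →
    n ≤ W * card P → n ≤ W * card Q → n ≤ W * card S → GoodTriangle
  good-triangle {c} {W} {n} dense-PQ dense-SP dense-SQ α-bound n≤WP n≤WQ n≤WS = decidable-stable good? absurd
    where
    n>0 : 0 < n
    n>0 = ℕP.≤-<-trans z≤n (α-bound (λ _ → false) (λ _ _ ()))
    card>0 : (Y : VSet size) → n ≤ W * card Y → 0 < card Y
    card>0 Y n≤WY = m*n>0⇒n>0 W (ℕP.<-≤-trans n>0 n≤WY)
    n≤W*4c* : (Y X : VSet size) → n ≤ W * card Y → card Y ≤ 4 * c * card X → n ≤ W * (4 * c) * card X
    n≤W*4c* Y X n≤WY Y≤LX = ℕP.≤-trans n≤WY
      (ℕP.≤-trans (ℕP.*-monoʳ-≤ W Y≤LX) (ℕP.≤-reflexive (sym (ℕP.*-assoc W (4 * c) (card X)))))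
    large-nbhds-absurd : ¬ GoodTriangle → ∀ {x} → T (S x) →
                         (∃ λ c₁ → card P ≤ 4 * c * card (nbhd x c₁ P)) →
                         (∃ λ c₂ → card Q ≤ 4 * c * card (nbhd x c₂ Q)) → ⊥
    large-nbhds-absurd no-good {x} x∈S (c₁ , P≤LA) (c₂ , Q≤LB) = ℕP.<-irrefl (sym AB≡0) (ℕP.*-mono-< A>0 B>0)
      where
      A = nbhd x c₁ P
      B = nbhd x c₂ Q
      A>0 : 0 < card A
      A>0 = m*n>0⇒n>0 (4 * c) (ℕP.<-≤-trans (card>0 P n≤WP) P≤LA)
      B>0 : 0 < card B
      B>0 = m*n>0⇒n>0 (4 * c) (ℕP.<-≤-trans (card>0 Q n≤WQ) Q≤LB)
      AB≡0 : card A * card B ≡ 0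
      AB≡0 = dense∧sparse⇒a*b≡0 {card A} {card B} {c} {eCount G A B} {n} {W * (4 * c)}
               (dense-PQ A B (λ u → proj₁ ∘ nbhd-elim x c₁ P) (λ v → proj₁ ∘ nbhd-elim x c₂ Q) P≤LA Q≤LB)
               (edge-bound no-good {suc (2 * c * (W * (4 * c)))} {n} {x} {c₁} {c₂} x∈S
                 (λ I indep → ℕP.<⇒≤ (α-bound I indep)))
               (n≤W*4c* P A n≤WP P≤LA) (n≤W*4c* Q B n≤WQ Q≤LB)
    absurd : ¬ GoodTriangle → ⊥
    absurd no-good with high-degree-vertex dense-SP dense-SQ (card>0 S n≤WS) (card>0 P n≤WP) (card>0 Q n≤WQ)
    ... | x , x∈S , P≤ , Q≤ =
      large-nbhds-absurd no-good x∈S (large-colour-class c x P P≤) (large-colour-class c x Q Q≤)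

open import Data.Rational as ℚ using (ℚ; mkℚ; 0ℚ; 1ℚ; _≤_; _<_; _*_; _-_; toℚᵘ)
import Data.Rational.Properties as ℚP
import Data.Rational.Unnormalised as ℚᵘ
import Data.Rational.Unnormalised.Properties as ℚᵘP
open import Data.Rational.Solver using (module +-*-Solver)
open +-*-Solver using (solve; _:=_; _:*_; _:-_)
open import Algebra.Bundles using (CommutativeMonoid)
open import Algebra.Properties.CommutativeSemigroup (CommutativeMonoid.commutativeSemigroup ℚP.*-1-commutativeMonoid)
  using (x∙yz≈y∙xz; x∙yz≈yx∙z)
open import Data.Integer as ℤ using (+_; +[1+_]; -[1+_])
import Data.Integer.Properties as ℤP
import Data.Nat.Coprimality as Coprime
open Arithmetic using (m*m≤e*[n*n]⇒m≤e*n)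
open Counting using (SubpairDense; subpairDense-sym)

toℚᵘ-ℕtoℚ : ∀ n → toℚᵘ (ℕtoℚ n) ≡ ℚᵘ.mkℚᵘ (+ n) 0
toℚᵘ-ℕtoℚ n = cong toℚᵘ (ℚP.normalize-coprime (Coprime.sym (Coprime.1-coprimeTo n)))

ℕtoℚ-* : ∀ m n → ℕtoℚ (m ℕ.* n) ≡ ℕtoℚ m * ℕtoℚ n
ℕtoℚ-* m n = ℚP.toℚᵘ-injective (begin-equality
  toℚᵘ (ℕtoℚ (m ℕ.* n))                 ≡⟨ toℚᵘ-ℕtoℚ (m ℕ.* n) ⟩
  ℚᵘ.mkℚᵘ (+ (m ℕ.* n)) 0               ≡⟨ cong (λ z → ℚᵘ.mkℚᵘ z 0) (ℤP.pos-* m n) ⟩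
  ℚᵘ.mkℚᵘ (+ m) 0 ℚᵘ.* ℚᵘ.mkℚᵘ (+ n) 0  ≡⟨ cong₂ ℚᵘ._*_ (toℚᵘ-ℕtoℚ m) (toℚᵘ-ℕtoℚ n) ⟨
  toℚᵘ (ℕtoℚ m) ℚᵘ.* toℚᵘ (ℕtoℚ n)      ≃⟨ ℚP.toℚᵘ-homo-* (ℕtoℚ m) (ℕtoℚ n) ⟨
  toℚᵘ (ℕtoℚ m * ℕtoℚ n)                ∎)
  where open ℚᵘP.≤-Reasoning

ℕtoℚ-mono-≤ : ∀ {m n} → m ℕ.≤ n → ℕtoℚ m ≤ ℕtoℚ n
ℕtoℚ-mono-≤ {m} {n} m≤n = ℚP.toℚᵘ-cancel-≤ (subst₂ ℚᵘ._≤_ (sym (toℚᵘ-ℕtoℚ m)) (sym (toℚᵘ-ℕtoℚ n))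
  (ℚᵘ.*≤* (ℤP.*-monoʳ-≤-nonNeg (+ 1) (ℤ.+≤+ m≤n))))

ℕtoℚ-cancel-≤ : ∀ {m n} → ℕtoℚ m ≤ ℕtoℚ n → m ℕ.≤ n
ℕtoℚ-cancel-≤ {m} {n} le with subst₂ ℚᵘ._≤_ (toℚᵘ-ℕtoℚ m) (toℚᵘ-ℕtoℚ n) (ℚP.toℚᵘ-mono-≤ le)
... | ℚᵘ.*≤* le₁ = ℤP.drop‿+≤+ (ℤP.*-cancelʳ-≤-pos _ _ (+ 1) le₁)

ℕtoℚ-mono-< : ∀ {m n} → m ℕ.< n → ℕtoℚ m < ℕtoℚ n
ℕtoℚ-mono-< {m} {n} m<n = ℚP.toℚᵘ-cancel-< (subst₂ ℚᵘ._<_ (sym (toℚᵘ-ℕtoℚ m)) (sym (toℚᵘ-ℕtoℚ n))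
  (ℚᵘ.*<* (ℤP.*-monoʳ-<-pos (+ 1) (ℤ.+<+ m<n))))

ℕtoℚ-cancel-< : ∀ {m n} → ℕtoℚ m < ℕtoℚ n → m ℕ.< n
ℕtoℚ-cancel-< {m} {n} lt with subst₂ ℚᵘ._<_ (toℚᵘ-ℕtoℚ m) (toℚᵘ-ℕtoℚ n) (ℚP.toℚᵘ-mono-< lt)
... | ℚᵘ.*<* lt₁ = ℤP.drop‿+<+ (ℤP.*-cancelʳ-<-nonNeg (+ 1) lt₁)

ℕtoℚ-nonNeg : ∀ n → 0ℚ ≤ ℕtoℚ n
ℕtoℚ-nonNeg n = ℕtoℚ-mono-≤ {0} {n} ℕ.z≤n

ℕtoℚ-nonNegative : ∀ n → ℚ.NonNegative (ℕtoℚ n)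
ℕtoℚ-nonNegative n = ℚ.nonNegative (ℕtoℚ-nonNeg n)

1/ℕ : (n : ℕ) .{{_ : ℕ.NonZero n}} → ℚ
1/ℕ (suc k) = mkℚ (+ 1) k (Coprime.1-coprimeTo (suc k))

1/ℕ-pos : ∀ n .{{_ : ℕ.NonZero n}} → 0ℚ < 1/ℕ n
1/ℕ-pos (suc k) = ℚ.*<* (ℤ.+<+ (ℕ.s≤s ℕ.z≤n))

*-1/ℕ : ∀ n .{{_ : ℕ.NonZero n}} → ℕtoℚ n * 1/ℕ n ≡ 1ℚ
*-1/ℕ (suc k) = ℚP.toℚᵘ-injective (begin-equality
  toℚᵘ (ℕtoℚ (suc k) * 1/ℕ (suc k))           ≃⟨ ℚP.toℚᵘ-homo-* (ℕtoℚ (suc k)) (1/ℕ (suc k)) ⟩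
  toℚᵘ (ℕtoℚ (suc k)) ℚᵘ.* toℚᵘ (1/ℕ (suc k))  ≡⟨ cong (ℚᵘ._* ℚᵘ.mkℚᵘ (+ 1) k) (toℚᵘ-ℕtoℚ (suc k)) ⟩
  ℚᵘ.mkℚᵘ (+ suc k) 0 ℚᵘ.* ℚᵘ.mkℚᵘ (+ 1) k     ≃⟨ ℚᵘ.*≡* cross ⟩
  toℚᵘ 1ℚ                                      ∎)
  where
  open ℚᵘP.≤-Reasoning
  cross : (+ suc k ℤ.* + 1) ℤ.* + 1 ≡ + 1 ℤ.* + suc (k ℕ.+ 0)
  cross = trans (ℤP.*-identityʳ _) (trans (ℤP.*-identityʳ _)
            (trans (cong (λ z → + suc z) (sym (ℕP.+-identityʳ k))) (sym (ℤP.*-identityˡ _))))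

1/↧≤ : ∀ {p} → 0ℚ < p → 1/ℕ (ℚ.↧ₙ p) ≤ p
1/↧≤ {mkℚ +[1+ a ] d _} _ = ℚ.*≤* (ℤ.+≤+ (ℕP.*-monoˡ-≤ (suc d) {1} {suc a} (ℕ.s≤s ℕ.z≤n)))
1/↧≤ {mkℚ (+ 0) _ _} (ℚ.*<* (ℤ.+<+ ()))
1/↧≤ {mkℚ -[1+ _ ] _ _} (ℚ.*<* ())

≤1/ℕ⇒*≤1 : ∀ {p} n .{{_ : ℕ.NonZero n}} → p ≤ 1/ℕ n → ℕtoℚ n * p ≤ 1ℚ
≤1/ℕ⇒*≤1 {p} n p≤1/n = begin
  ℕtoℚ n * p      ≤⟨ ℚP.*-monoˡ-≤-nonNeg (ℕtoℚ n) {{ℕtoℚ-nonNegative n}} p≤1/n ⟩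
  ℕtoℚ n * 1/ℕ n  ≡⟨ *-1/ℕ n ⟩
  1ℚ              ∎
  where open ℚP.≤-Reasoning

archimedean : ∀ {p} → 0ℚ < p → ∃ λ k → 1ℚ ≤ ℕtoℚ (suc k) * p
archimedean {p} p>0 = k , (begin
  1ℚ                          ≡⟨ *-1/ℕ (suc k) ⟨
  ℕtoℚ (suc k) * 1/ℕ (suc k)  ≤⟨ ℚP.*-monoˡ-≤-nonNeg (ℕtoℚ (suc k)) {{ℕtoℚ-nonNegative (suc k)}} (1/↧≤ p>0) ⟩
  ℕtoℚ (suc k) * p            ∎)
  where
  open ℚP.≤-Reasoning
  k = ℚ.denominator-1 p

*-divℕ : ∀ e s → ℕtoℚ (suc s) * divℕ e (suc s) ≡ ℕtoℚ e
*-divℕ e s = ℚP.toℚᵘ-injective (begin-equality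
  toℚᵘ (ℕtoℚ (suc s) * divℕ e (suc s))            ≃⟨ ℚP.toℚᵘ-homo-* (ℕtoℚ (suc s)) (divℕ e (suc s)) ⟩
  toℚᵘ (ℕtoℚ (suc s)) ℚᵘ.* toℚᵘ (divℕ e (suc s))  ≃⟨ ℚᵘP.*-congˡ {toℚᵘ (ℕtoℚ (suc s))} (ℚP.toℚᵘ-fromℚᵘ (ℚᵘ.mkℚᵘ (+ e) s)) ⟩
  toℚᵘ (ℕtoℚ (suc s)) ℚᵘ.* ℚᵘ.mkℚᵘ (+ e) s        ≡⟨ cong (ℚᵘ._* ℚᵘ.mkℚᵘ (+ e) s) (toℚᵘ-ℕtoℚ (suc s)) ⟩
  ℚᵘ.mkℚᵘ (+ suc s) 0 ℚᵘ.* ℚᵘ.mkℚᵘ (+ e) s        ≃⟨ ℚᵘ.*≡* cross ⟩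
  ℚᵘ.mkℚᵘ (+ e) 0                                 ≡⟨ toℚᵘ-ℕtoℚ e ⟨
  toℚᵘ (ℕtoℚ e)                                   ∎)
  where
  open ℚᵘP.≤-Reasoning
  cross : (+ suc s ℤ.* + e) ℤ.* + 1 ≡ + e ℤ.* +[1+ s ℕ.+ 0 ℕ.* suc s ]
  cross = trans (ℤP.*-identityʳ _) (trans (ℤP.*-comm (+ suc s) (+ e))
            (cong (λ z → + e ℤ.* +[1+ z ]) (sym (ℕP.+-identityʳ s))))

1≤c*e/s⇒s≤c*e : ∀ {c e s} → 1ℚ ≤ ℕtoℚ c * divℕ e s → s ℕ.≤ c ℕ.* e
1≤c*e/s⇒s≤c*e {s = zero} _ = ℕ.z≤n
1≤c*e/s⇒s≤c*e {c} {e} {suc s} 1≤c*e/s = ℕtoℚ-cancel-≤ (begin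
  ℕtoℚ (suc s)                              ≡⟨ ℚP.*-identityʳ _ ⟨
  ℕtoℚ (suc s) * 1ℚ                         ≤⟨ ℚP.*-monoˡ-≤-nonNeg (ℕtoℚ (suc s)) {{ℕtoℚ-nonNegative (suc s)}} 1≤c*e/s ⟩
  ℕtoℚ (suc s) * (ℕtoℚ c * divℕ e (suc s))  ≡⟨ x∙yz≈y∙xz (ℕtoℚ (suc s)) (ℕtoℚ c) (divℕ e (suc s)) ⟩
  ℕtoℚ c * (ℕtoℚ (suc s) * divℕ e (suc s))  ≡⟨ cong (ℕtoℚ c *_) (*-divℕ e s) ⟩
  ℕtoℚ c * ℕtoℚ e                           ≡⟨ ℕtoℚ-* c e ⟨
  ℕtoℚ (c ℕ.* e)                            ∎)
  where open ℚP.≤-Reasoning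

x*x≤1⇒x≤1 : ∀ {x} → x * x ≤ 1ℚ → x ≤ 1ℚ
x*x≤1⇒x≤1 {x} xx≤1 with ℚP.≤-total x 1ℚ
... | inj₁ x≤1 = x≤1
... | inj₂ 1≤x = begin
  x       ≡⟨ ℚP.*-identityˡ x ⟨
  1ℚ * x  ≤⟨ ℚP.*-monoʳ-≤-nonNeg x {{ℚ.nonNegative (ℚP.≤-trans (ℕtoℚ-nonNeg 1) 1≤x)}} 1≤x ⟩
  x * x   ≤⟨ xx≤1 ⟩
  1ℚ      ∎
  where open ℚP.≤-Reasoning

-- (d₁ - d)² ≤ ε ≤ 1/t² gives t (d - d₁) ≤ 1, and t ε ≤ 1, so t d₁ ≥ t β - t ε - t (d - d₁) ≥ 3 - 2.
close⇒dense : ∀ {t β ε d d₁} → 1ℚ ≤ t → 0ℚ ≤ ε → ℕtoℚ 3 ≤ t * β → t * t * ε ≤ 1ℚ →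
              β - ε ≤ d → (d₁ - d) * (d₁ - d) ≤ ε → 1ℚ ≤ t * d₁
close⇒dense {t} {β} {ε} {d} {d₁} 1≤t ε≥0 3≤tβ ttε≤1 β-ε≤d close = begin
  1ℚ                            ≡⟨ refl ⟩
  ℕtoℚ 3 - 1ℚ - 1ℚ              ≤⟨ ℚP.+-mono-≤ (ℚP.+-mono-≤ 3≤tβ (ℚP.neg-antimono-≤ tε≤1)) (ℚP.neg-antimono-≤ tδ≤1) ⟩
  t * β - t * ε - t * (d - d₁)  ≡⟨ factor t β ε (t * (d - d₁)) ⟩
  t * (β - ε) - t * (d - d₁)    ≤⟨ ℚP.+-monoˡ-≤ (ℚ.- (t * (d - d₁))) (ℚP.*-monoˡ-≤-nonNeg t {{t≥0}} β-ε≤d) ⟩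
  t * d - t * (d - d₁)          ≡⟨ cancel t d d₁ ⟩
  t * d₁                        ∎
  where
  open ℚP.≤-Reasoning
  t≥0 = ℚ.nonNegative (ℚP.≤-trans (ℕtoℚ-nonNeg 1) 1≤t)
  factor : ∀ t β ε r → t * β - t * ε - r ≡ t * (β - ε) - r
  factor = solve 4 (λ t β ε r → t :* β :- t :* ε :- r := t :* (β :- ε) :- r) refl
  cancel : ∀ t d d₁ → t * d - t * (d - d₁) ≡ t * d₁
  cancel = solve 3 (λ t d d₁ → t :* d :- t :* (d :- d₁) := t :* d₁) refl
  square : ∀ t d d₁ → t * (d - d₁) * (t * (d - d₁)) ≡ t * t * ((d₁ - d) * (d₁ - d))
  square = solve 3 (λ t d d₁ → t :* (d :- d₁) :* (t :* (d :- d₁)) := t :* t :* ((d₁ :- d) :* (d₁ :- d))) refl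
  tε≤1 : t * ε ≤ 1ℚ
  tε≤1 = begin
    t * ε         ≡⟨ ℚP.*-identityˡ (t * ε) ⟨
    1ℚ * (t * ε)  ≤⟨ ℚP.*-monoʳ-≤-nonNeg (t * ε) {{ℚP.nonNeg*nonNeg⇒nonNeg t {{t≥0}} ε {{ℚ.nonNegative ε≥0}}}} 1≤t ⟩
    t * (t * ε)   ≡⟨ ℚP.*-assoc t t ε ⟨
    t * t * ε     ≤⟨ ttε≤1 ⟩
    1ℚ            ∎
  tδ≤1 : t * (d - d₁) ≤ 1ℚ
  tδ≤1 = x*x≤1⇒x≤1 (begin
    t * (d - d₁) * (t * (d - d₁))  ≡⟨ square t d d₁ ⟩
    t * t * ((d₁ - d) * (d₁ - d))  ≤⟨ ℚP.*-monoˡ-≤-nonNeg (t * t) {{ℚP.nonNeg*nonNeg⇒nonNeg t {{t≥0}} t {{t≥0}}}} close ⟩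
    t * t * ε                      ≤⟨ ttε≤1 ⟩
    1ℚ                             ∎)

≤-rescale : ∀ E {ε x y} → 0ℚ ≤ x → 1ℚ ≤ ℕtoℚ E * ε → ε * x ≤ y → x ≤ ℕtoℚ E * y
≤-rescale E {ε} {x} {y} x≥0 1≤Eε εx≤y = begin
  x                 ≡⟨ ℚP.*-identityˡ x ⟨
  1ℚ * x            ≤⟨ ℚP.*-monoʳ-≤-nonNeg x {{ℚ.nonNegative x≥0}} 1≤Eε ⟩
  ℕtoℚ E * ε * x    ≡⟨ ℚP.*-assoc (ℕtoℚ E) ε x ⟩
  ℕtoℚ E * (ε * x)  ≤⟨ ℚP.*-monoˡ-≤-nonNeg (ℕtoℚ E) {{ℕtoℚ-nonNegative E}} εx≤y ⟩
  ℕtoℚ E * y        ∎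
  where open ℚP.≤-Reasoning

√εm≤p⇒n≤M*E*p : ∀ {ε μ} E M m n p .{{_ : ℕ.NonZero E}} → 1ℚ ≤ ℕtoℚ E * ε → 1ℚ ≤ ℕtoℚ M * μ →
                ℕtoℚ m ≡ μ * ℕtoℚ n → ε * (ℕtoℚ m * ℕtoℚ m) ≤ ℕtoℚ p * ℕtoℚ p → n ℕ.≤ M ℕ.* E ℕ.* p
√εm≤p⇒n≤M*E*p {ε} {μ} E M m n p 1≤Eε 1≤Mμ m≡μn εmm≤pp = begin
  n                ≤⟨ n≤Mm ⟩
  M ℕ.* m          ≤⟨ ℕP.*-monoʳ-≤ M (m*m≤e*[n*n]⇒m≤e*n mm≤Epp) ⟩
  M ℕ.* (E ℕ.* p)  ≡⟨ ℕP.*-assoc M E p ⟨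
  M ℕ.* E ℕ.* p    ∎
  where
  open ℕP.≤-Reasoning
  n≤Mm : n ℕ.≤ M ℕ.* m
  n≤Mm = ℕtoℚ-cancel-≤ (subst (ℕtoℚ n ≤_) (sym (ℕtoℚ-* M m))
           (≤-rescale M (ℕtoℚ-nonNeg n) 1≤Mμ (ℚP.≤-reflexive (sym m≡μn))))
  mm≤Epp : m ℕ.* m ℕ.≤ E ℕ.* (p ℕ.* p)
  mm≤Epp = ℕtoℚ-cancel-≤ (subst₂ _≤_ (sym (ℕtoℚ-* m m))
             (sym (trans (ℕtoℚ-* E (p ℕ.* p)) (cong (ℕtoℚ E *_) (ℕtoℚ-* p p))))
             (≤-rescale E (subst (0ℚ ≤_) (ℕtoℚ-* m m) (ℕtoℚ-nonNeg (m ℕ.* m))) 1≤Eε εmm≤pp))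

i<αn⇒D*i<n : ∀ {α} D i n .{{_ : ℕ.NonZero D}} → ℕtoℚ i < α * ℕtoℚ n → ℕtoℚ D * α ≤ 1ℚ → D ℕ.* i ℕ.< n
i<αn⇒D*i<n {α} D i n i<αn Dα≤1 = ℕtoℚ-cancel-< (begin-strict
  ℕtoℚ (D ℕ.* i)          ≡⟨ ℕtoℚ-* D i ⟩
  ℕtoℚ D * ℕtoℚ i         <⟨ ℚP.*-monoʳ-<-pos (ℕtoℚ D) {{D>0}} i<αn ⟩
  ℕtoℚ D * (α * ℕtoℚ n)   ≡⟨ ℚP.*-assoc (ℕtoℚ D) α (ℕtoℚ n) ⟨
  ℕtoℚ D * α * ℕtoℚ n     ≤⟨ ℚP.*-monoʳ-≤-nonNeg (ℕtoℚ n) {{ℕtoℚ-nonNegative n}} Dα≤1 ⟩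
  1ℚ * ℕtoℚ n             ≡⟨ ℚP.*-identityˡ (ℕtoℚ n) ⟩
  ℕtoℚ n                  ∎)
  where
  open ℚP.≤-Reasoning
  D>0 = ℚ.positive (ℕtoℚ-mono-< {0} {D} (ℕ.>-nonZero⁻¹ D))

a≤L*x⇒εa²≤x² : ∀ {L a x ε} → 0ℚ ≤ ε → ℕtoℚ (L ℕ.* L) * ε ≤ 1ℚ → a ℕ.≤ L ℕ.* x →
               ε * (ℕtoℚ a * ℕtoℚ a) ≤ ℕtoℚ x * ℕtoℚ x
a≤L*x⇒εa²≤x² {L} {a} {x} {ε} ε≥0 LLε≤1 a≤Lx = begin
  ε * (ℕtoℚ a * ℕtoℚ a)                  ≡⟨ cong (ε *_) (ℕtoℚ-* a a) ⟨
  ε * ℕtoℚ (a ℕ.* a)                     ≤⟨ ℚP.*-monoˡ-≤-nonNeg ε {{ℚ.nonNegative ε≥0}} (ℕtoℚ-mono-≤ aa≤LLxx) ⟩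
  ε * ℕtoℚ (L ℕ.* L ℕ.* (x ℕ.* x))       ≡⟨ cong (ε *_) (ℕtoℚ-* (L ℕ.* L) (x ℕ.* x)) ⟩
  ε * (ℕtoℚ (L ℕ.* L) * ℕtoℚ (x ℕ.* x))  ≡⟨ x∙yz≈yx∙z ε (ℕtoℚ (L ℕ.* L)) (ℕtoℚ (x ℕ.* x)) ⟩
  ℕtoℚ (L ℕ.* L) * ε * ℕtoℚ (x ℕ.* x)    ≤⟨ ℚP.*-monoʳ-≤-nonNeg (ℕtoℚ (x ℕ.* x)) {{ℕtoℚ-nonNegative (x ℕ.* x)}} LLε≤1 ⟩
  1ℚ * ℕtoℚ (x ℕ.* x)                    ≡⟨ ℚP.*-identityˡ _ ⟩
  ℕtoℚ (x ℕ.* x)                         ≡⟨ ℕtoℚ-* x x ⟩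
  ℕtoℚ x * ℕtoℚ x                        ∎
  where
  open ℚP.≤-Reasoning
  aa≤LLxx : a ℕ.* a ℕ.≤ L ℕ.* L ℕ.* (x ℕ.* x)
  aa≤LLxx = ℕP.≤-trans (ℕP.*-mono-≤ a≤Lx a≤Lx) (ℕP.≤-reflexive (regroup L x))
    where
    regroup : ∀ L x → L ℕ.* x ℕ.* (L ℕ.* x) ≡ L ℕ.* L ℕ.* (x ℕ.* x)
    regroup = solve-∀

regular⇒subpairDense : ∀ {G ε β A B} k L → 0ℚ ≤ ε → ℕtoℚ (L ℕ.* L) * ε ≤ 1ℚ → 1 ℕ.≤ k → 3 ℕ.* k ℕ.≤ L →
  1ℚ ≤ ℕtoℚ k * β → SqrtRegular G ε A B → β - ε ≤ density G A B → SubpairDense G L (3 ℕ.* k) A B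
regular⇒subpairDense {G} {ε} {β} k L ε≥0 LLε≤1 k≥1 3k≤L 1≤kβ regular β-ε≤d X Y X⊆A Y⊆B A≤LX B≤LY =
  1≤c*e/s⇒s≤c*e {3 ℕ.* k} (close⇒dense 1≤t ε≥0 3≤tβ ttε≤1 β-ε≤d
    (regular X Y X⊆A Y⊆B (a≤L*x⇒εa²≤x² {L} ε≥0 LLε≤1 A≤LX) (a≤L*x⇒εa²≤x² {L} ε≥0 LLε≤1 B≤LY)))
  where
  open ℚP.≤-Reasoning
  t = ℕtoℚ (3 ℕ.* k)
  1≤t : 1ℚ ≤ t
  1≤t = ℕtoℚ-mono-≤ (ℕP.≤-trans k≥1 (ℕP.m≤n*m k 3))
  3≤tβ : ℕtoℚ 3 ≤ t * β
  3≤tβ = begin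
    ℕtoℚ 3                 ≡⟨ ℚP.*-identityʳ (ℕtoℚ 3) ⟨
    ℕtoℚ 3 * 1ℚ            ≤⟨ ℚP.*-monoˡ-≤-nonNeg (ℕtoℚ 3) {{ℕtoℚ-nonNegative 3}} 1≤kβ ⟩
    ℕtoℚ 3 * (ℕtoℚ k * β)  ≡⟨ ℚP.*-assoc (ℕtoℚ 3) (ℕtoℚ k) β ⟨
    ℕtoℚ 3 * ℕtoℚ k * β    ≡⟨ cong (_* β) (ℕtoℚ-* 3 k) ⟨
    t * β                  ∎
  ttε≤1 : t * t * ε ≤ 1ℚ
  ttε≤1 = begin
    t * t * ε                         ≡⟨ cong (_* ε) (ℕtoℚ-* (3 ℕ.* k) (3 ℕ.* k)) ⟨
    ℕtoℚ (3 ℕ.* k ℕ.* (3 ℕ.* k)) * ε  ≤⟨ ℚP.*-monoʳ-≤-nonNeg ε {{ℚ.nonNegative ε≥0}} (ℕtoℚ-mono-≤ (ℕP.*-mono-≤ 3k≤L 3k≤L)) ⟩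
    ℕtoℚ (L ℕ.* L) * ε                ≤⟨ LLε≤1 ⟩
    1ℚ                                ∎

lemma4p2 : (β : ℚ) → 0ℚ < β →
    Σ ℚ λ ε₀ → 0ℚ < ε₀ × ((ε : ℚ) → 0ℚ < ε → ε ≤ ε₀ →
    Σ ℚ λ μ₀ → 0ℚ < μ₀ × ((μ : ℚ) → 0ℚ < μ → μ ≤ μ₀ →
    Σ ℚ λ α₀ → 0ℚ < α₀ × ((α : ℚ) → 0ℚ < α → α ≤ α₀ →
    Σ ℕ λ N → (n m : ℕ) → N ℕ.≤ n → ℕtoℚ m ≡ μ * ℕtoℚ n →
    (G : Graph) → (part : Fin (Graph.size G) → Fin 3) →
    let P = λ v → isYes (part v Fin.≟ Fin.zero)
        Q = λ v → isYes (part v Fin.≟ Fin.suc Fin.zero)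
        S = λ v → isYes (part v Fin.≟ Fin.suc (Fin.suc Fin.zero))
    in
    card P ℕ.≤ n → card Q ℕ.≤ n → card S ℕ.≤ n →
    ε * (ℕtoℚ m * ℕtoℚ m) ≤ ℕtoℚ (card P) * ℕtoℚ (card P) →
    ε * (ℕtoℚ m * ℕtoℚ m) ≤ ℕtoℚ (card Q) * ℕtoℚ (card Q) →
    ε * (ℕtoℚ m * ℕtoℚ m) ≤ ℕtoℚ (card S) * ℕtoℚ (card S) →
    ((I : VSet (Graph.size G)) → Independent G I → ℕtoℚ (card I) < α * ℕtoℚ n) →
    SqrtRegular G ε P Q → SqrtRegular G ε Q S → SqrtRegular G ε S P →
    β - ε ≤ density G P Q → β - ε ≤ density G Q S → β - ε ≤ density G S P →
    (φ : Fin (Graph.size G) → Fin (Graph.size G) → Bool) →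
    (∀ u v → φ u v ≡ φ v u) →
    Σ (Fin (Graph.size G)) λ x → Σ (Fin (Graph.size G)) λ y → Σ (Fin (Graph.size G)) λ z →
      x ≢ y × y ≢ z × x ≢ z ×
      Graph.adj G x y ≡ true × Graph.adj G y z ≡ true × Graph.adj G x z ≡ true ×
      φ x y ≡ φ y z × φ y z ≡ φ x z ×
      ind (S x) ℕ.+ ind (S y) ℕ.+ ind (S z) ℕ.≤ 1 ×
      ind (P x) ℕ.+ ind (P y) ℕ.+ ind (P z) ℕ.≤ 2 ×
      ind (Q x) ℕ.+ ind (Q y) ℕ.+ ind (Q z) ℕ.≤ 2)))
-- With k β ≥ 1 and L = 12k, ε₀ = 1/L² makes every subpair of relative size 1/L of a regular pair
-- have density at least 1/(3k).
lemma4p2 β β>0 = 1/ℕ (L ℕ.* L) , 1/ℕ-pos (L ℕ.* L) , λ ε ε>0 ε≤ε₀ →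
  1ℚ , 1/ℕ-pos 1 , λ μ μ>0 _ →
  let (E-1 , 1≤Eε) = archimedean ε>0
      (M-1 , 1≤Mμ) = archimedean μ>0
      E = suc E-1
      M = suc M-1
      D = suc (2 ℕ.* c ℕ.* (M ℕ.* E ℕ.* L))
  in 1/ℕ D , 1/ℕ-pos D , λ α α>0 α≤1/D →
  0 , λ n m _ m≡μn G part _ _ _ εm²≤P² εm²≤Q² εm²≤S² α-bound reg-PQ reg-QS reg-SP dPQ dQS dSP φ φ-sym →
  let open Tripartition G part φ φ-sym
      dense : ∀ A B → SqrtRegular G ε A B → β - ε ≤ density G A B → SubpairDense G L c A B
      dense A B = regular⇒subpairDense {G} {ε} {β} {A} {B} k L (ℚP.<⇒≤ ε>0) (≤1/ℕ⇒*≤1 (L ℕ.* L) ε≤ε₀)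
                    (ℕ.s≤s ℕ.z≤n) (ℕP.m≤n*m c 4) 1≤kβ
      large : ∀ {p} → ε * (ℕtoℚ m * ℕtoℚ m) ≤ ℕtoℚ p * ℕtoℚ p → n ℕ.≤ M ℕ.* E ℕ.* p
      large {p} = √εm≤p⇒n≤M*E*p E M m n p 1≤Eε 1≤Mμ m≡μn
  in good-triangle {c} {M ℕ.* E} {n} (dense P Q reg-PQ dPQ) (dense S P reg-SP dSP)
       (subpairDense-sym {G} {L} {c} {Q} {S} (dense Q S reg-QS dQS))
       (λ I indep → i<αn⇒D*i<n D (card I) n (α-bound I indep) (≤1/ℕ⇒*≤1 D α≤1/D))
       (large εm²≤P²) (large εm²≤Q²) (large εm²≤S²)
  where
  k = suc (proj₁ (archimedean β>0))
  1≤kβ = proj₂ (archimedean β>0)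
  c = 3 ℕ.* k
  L = 4 ℕ.* c
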